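{- Let $\alpha\geq 1$ and $i$ be integers with $0<i<\min(\alpha,i_{\max}+1)$. Let $\Sigma_A^{=0}(i)=\{a\in\Sigma_A(i):\mathbf{T}_i(a)=0\}$ and $\Sigma_A^{\neq 0}(i)=\{a\in\Sigma_A(i):\mathbf{T}_i(a)\neq 0\}$. Then $$A_i(\alpha)=|\Sigma_A^{=0}(i)|\cdot A\big(\alpha-(i+1)\big)+\sum_{a\in\Sigma_A^{\neq 0}(i)}\ \sum_{i'=i-\mathbf{T}_i(a)+2}^{i_{\max}} A_{i'}\big(\alpha-\mathbf{T}_i(a)+1\big).$$
   Context: Let $\Sigma$ be a finite totally ordered alphabet with $|\Sigma|=2^b$; each letter is identified bijectively with a $b$-bit vector and $a\oplus a'$ is the letter whose bit vector is the componentwise XOR. For equal-length words, $\oplus$ acts letterwise; equal-length words are compared lexicographically. An $m$-mer of a word is a contiguous factor of length $m$. Fix integers $1\le m<k$, a word $w=a_1\cdots a_m\in\Sigma^m$ and a key $\gamma=c_1\cdots c_m\in\Sigma^m$. Autocorrelation matrix: for $1\le j\le i\le m$, $\mathbf{R}_{i,j}\in\{<,=,>\}$ is the relation with $\big((a_j\cdots a_i)\oplus(c_1\cdots c_{i-j+1})\big)\ \mathbf{R}_{i,j}\ \big((a_1\cdots a_{i-j+1})\oplus(c_1\cdots c_{i-j+1})\big)$; write $\mathbf{R}^\star_{i,j}=[\mathbf{R}_{i,j}=\star]$. $i_{\max}=\min\big(\{m\}\cup\{2\le i\le m-1:\exists\, 2\le j\le i \text{ with } \mathbf{R}_{i,j}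 \text{ equal to } <\}\big)-1$. Specialized alphabets: for $1\le i\le m$, $\Sigma_i=\{a\in\Sigma: a\oplus c_i>a_i\oplus c_i\}$. $\Sigma_A(i)=\Sigma_{i+1}\cap(\Sigma_1\cup\{a_1\})\cap\bigcap_{2\le j\le i,\ \mathbf{R}^=_{i,j}}(\Sigma_{i-j+2}\cup\{a_{i-j+2}\})$. Prefix-letter vectors: $\mathbf{T}_1(a)=2\cdot[a=a_1]$; for $2\le i\le m$, $\mathbf{T}_i(a)=\min\{2\le j\le i:\mathbf{R}^=_{i,j}\text{ and } a_{i-j+2}=a\}$ if this set is nonempty, and $\mathbf{T}_i(a)=(i+1)\cdot[a=a_1]$ otherwise. A word $y$ is an antemer if every $m$-mer $w'$ of the word $yw$ other than the last one (the suffix $w$) satisfies $w'\oplus\gamma>w\oplus\gamma$. $A(\alpha)$ is the number of antemers of length $\alpha$ (with $A(0)=1$), and $A_i(\alpha)$ is the number of antemers of length $\alpha$ whose longest common prefix with $w$ has length exactly $i$ ($A_i(\alpha)=0$ for $i>\alpha$). -}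

module Defs where

open import Data.Nat using (ℕ; zero; suc; _+_; _*_; _∸_; _^_; _⊓_)
open import Data.Bool using (Bool; true; false; _∧_; _∨_; _xor_; not; if_then_else_)
open import Data.Fin using (Fin)
open import Data.Fin.Properties using (<-cmp) renaming (_≟_ to _≟F_)
open import Data.List using (List; []; _∷_; length; map; filter; foldr; take; drop; zipWith; upTo; allFin; concatMap; _++_)
open import Data.Bool.ListAction using (all; any)
open import Data.Vec using (Vec; toList; replicate)
open import Function.Bundles using (_↔_; Inverse)
open import Relation.Binary.Definitions using (tri<; tri≈; tri>)
open import Relation.Nullary.Decidable using (⌊_⌋)

data Rel3 : Set where
  lt eq gt : Rel3

isLt isEq isGt : Rel3 → Bool
isLt lt = true
isLt _  = false
isEq eq = true
isEq _  = false
isGt gt = true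
isGt _  = false

range : ℕ → ℕ → List ℕ
range lo hi = map (lo +_) (upTo (suc hi ∸ lo))

-- Σ is identified with Fin (2 ^ b), with the order of Fin (any finite total
-- order is isomorphic to this one); the bijection with b-bit vectors is an
-- arbitrary parameter  enc.
module Antemer (b : ℕ) (enc : Fin (2 ^ b) ↔ Vec Bool b) {m : ℕ}
               (wv γv : Vec (Fin (2 ^ b)) m) where

  L : Set
  L = Fin (2 ^ b)

  _⊕_ : L → L → L
  x ⊕ y = Inverse.from enc (Data.Vec.zipWith _xor_ (Inverse.to enc x) (Inverse.to enc y))

  _==_ : L → L → Bool
  x == y = ⌊ x ≟F y ⌋

  cmpL : L → L → Rel3
  cmpL x y with <-cmp x y
  ... | tri< _ _ _ = lt
  ... | tri≈ _ _ _ = eq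
  ... | tri> _ _ _ = gt

  -- lexicographic comparison (only used on words of equal length)
  lexCmp : List L → List L → Rel3
  lexCmp (x ∷ xs) (y ∷ ys) with cmpL x y
  ... | lt = lt
  ... | gt = gt
  ... | eq = lexCmp xs ys
  lexCmp _ _ = eq

  _⊕w_ : List L → List L → List L
  _⊕w_ = zipWith _⊕_

  w γ : List L
  w = toList wv
  γ = toList γv

  -- default letter (never used: all accesses below are in range)
  dflt : L
  dflt = Inverse.from enc (replicate b false)

  -- 1-based letter access
  at : List L → ℕ → L
  at xs zero = dflt
  at [] (suc _) = dflt
  at (x ∷ xs) (suc zero) = x
  at (x ∷ xs) (suc (suc n)) = at xs (suc n)

  a c : ℕ → L
  a = at w
  c = at γ

  -- factor  x_j ⋯ x_i  (1-based, inclusive)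
  fac : List L → ℕ → ℕ → List L
  fac xs j i = take (suc i ∸ j) (drop (j ∸ 1) xs)

  pref : List L → ℕ → List L
  pref xs n = take n xs

  R : ℕ → ℕ → Rel3
  R i j = lexCmp (fac w j i ⊕w pref γ (suc i ∸ j))
                 (pref w (suc i ∸ j) ⊕w pref γ (suc i ∸ j))

  badRow : ℕ → Bool
  badRow i = any (λ j → isLt (R i j)) (range 2 i)

  imax : ℕ
  imax = foldr _⊓_ m (filter (λ i → badRow i Data.Bool.≟ true) (range 2 (m ∸ 1))) ∸ 1

  inΣ : ℕ → L → Bool
  inΣ i x = isGt (cmpL (x ⊕ c i) (a i ⊕ c i))

  inΣA : ℕ → L → Bool
  inΣA i x = inΣ (suc i) x ∧ (inΣ 1 x ∨ (x == a 1))
             ∧ all (λ j → not (isEq (R i j)) ∨ inΣ (suc (suc i) ∸ j) x ∨ (x == a (suc (suc i) ∸ j)))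
                   (range 2 i)

  -- prefix-letter vectors  T i x ; the candidate list is increasing, so its
  -- head is the minimum.  (For i = 1 the list is empty and this gives 2·[x = a₁].)
  T : ℕ → L → ℕ
  T i x with filter (λ j → (isEq (R i j) ∧ (a (suc (suc i) ∸ j) == x)) Data.Bool.≟ true) (range 2 i)
  ... | j ∷ _ = j
  ... | []    = if x == a 1 then suc i else 0

  words : ℕ → List (List L)
  words zero = [] ∷ []
  words (suc n) = concatMap (λ x → map (x ∷_) (words n)) (allFin (2 ^ b))

  countB : {X : Set} → (X → Bool) → List X → ℕ
  countB p xs = length (filter (λ x → p x Data.Bool.≟ true) xs)

  -- y is an antemer: every m-mer of y w except the last (the suffix w),
  -- i.e. those starting at positions 0 .. |y|-1, is  ⊕γ-larger than w
  isAntemer : List L → Bool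
  isAntemer y = all (λ p → isGt (lexCmp (take m (drop p (y ++ w)) ⊕w γ) (w ⊕w γ)))
                    (upTo (length y))

  lcp : List L → List L → ℕ
  lcp (x ∷ xs) (y ∷ ys) = if x == y then suc (lcp xs ys) else 0
  lcp _ _ = 0

  A : ℕ → ℕ
  A α = countB isAntemer (words α)

  Ai : ℕ → ℕ → ℕ
  Ai i α = countB (λ y → isAntemer y ∧ ⌊ lcp y w Data.Nat.≟ i ⌋) (words α)

  ΣA0size : ℕ → ℕ
  ΣA0size i = countB (λ x → inΣA i x ∧ ⌊ T i x Data.Nat.≟ 0 ⌋) (allFin (2 ^ b))

  ΣAnz : ℕ → List L
  ΣAnz i = filter (λ x → (inΣA i x ∧ not ⌊ T i x Data.Nat.≟ 0 ⌋) Data.Bool.≟ true) (allFin (2 ^ b))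

-- An antemer y of length α with lcp(y, w) = i is y = a₁⋯aᵢ x z with x ≠ aᵢ₊₁ and
-- |z| = α − i − 1. Only the m-mers of y w starting at p = 0, …, i involve x; the one
-- at p first compares aₚ₊₁⋯aᵢ with a₁⋯aᵢ₋ₚ (the entry R i (p + 1), never < because
-- i ≤ imax) and then x with aᵢ₋ₚ₊₁. If x ∉ Σ_A(i), one of them is smaller than w.
-- If x ∈ Σ_A(i), all of them are larger than w before the first p at which
-- R i (p + 1) is = and x = aᵢ₋ₚ₊₁, and that p is Tᵢ(x) − 1. Without such a p, y is an
-- antemer iff z is, giving |Σ_A^{=0}(i)| · A(α − i − 1). Otherwise y is an antemer iff
-- its suffix a₁⋯a_{i−T+2} z from position T − 1 is one; these suffixes are counted by
-- their lcp with w, which lies in [i − T + 2, imax] because no antemer agrees with w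
-- on imax + 1 letters.

module Submission where

open import Defs
open import Data.Bool using (Bool; true; false; _∧_; _∨_; not; if_then_else_; _xor_)
import Data.Bool as Bool
open import Data.Bool.ListAction using (all; any; and)
open import Data.Bool.Properties using (∧-zeroʳ; ∧-identityʳ; xor-assoc; xor-same; xor-identityʳ; not-injective; T-≡; ∧-conicalˡ; ∧-conicalʳ; ∨-conicalˡ; ∨-conicalʳ)
open import Data.Fin using (Fin)
import Data.Fin as Fin
import Data.Fin.Properties as Fin
open import Data.List using (List; []; _∷_; length; map; filter; foldr; take; drop; upTo; applyUpTo; _++_; concatMap; tabulate; allFin; zipWith)
open import Data.List.Properties using (length-++; ∷-injectiveˡ; ∷-injectiveʳ; ++-assoc; length-take; length-zipWith; take++drop≡id; take-all; drop-all; take-drop; length-drop; map-++; map-cong; map-∘; map-tabulate; map-upTo; map-applyUpTo; foldr-preservesʳ; foldr-preservesᵒ)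
open import Data.List.Membership.Propositional using (_∈_)
open import Data.List.Membership.Propositional.Properties using (foldr-selective; ∈-map⁺; ∈-map⁻; ∈-upTo⁺; ∈-upTo⁻; ∈-filter⁻; ∈-filter⁺)
open import Data.List.Relation.Unary.Any using (here; there)
import Data.List.Relation.Unary.Any as Any
open import Data.Nat using (ℕ; zero; suc; _+_; _*_; _∸_; _^_; _≤_; _<_; z≤n; s≤s; _⊓_; _≟_; _≤?_; s≤s⁻¹; z<s)
open import Data.Nat.ListAction using (sum)
open import Data.Nat.ListAction.Properties using (sum-++)
open import Data.Nat.Properties
open import Data.Product using (∃-syntax; _×_; _,_; proj₁; proj₂; uncurry)
open import Data.Sum using (_⊎_; inj₁; inj₂; [_,_])
open import Data.Vec using (Vec)
import Data.Vec as Vec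
import Data.Vec.Properties as Vec
open import Function using (_∘_; case_of_)
open import Function.Bundles using (_↔_; Inverse; Equivalence)
open import Algebra.Properties.CommutativeSemigroup +-commutativeSemigroup using (interchange; x∙yz≈y∙xz)
open import Relation.Binary.Definitions using (tri<; tri≈; tri>)
open import Relation.Binary.PropositionalEquality hiding ([_])
open import Relation.Nullary using (¬_; yes; no; contradiction)
open import Relation.Nullary.Decidable using (toWitness; ⌊_⌋; Dec; isYes≗does; dec-true; dec-false)

iverson : Bool → ℕ
iverson true  = 1
iverson false = 0

count : {X : Set} → (X → Bool) → List X → ℕ
count p xs = sum (map (iverson ∘ p) xs)

module _ {X : Set} where

  length-filter≡count : ∀ (p : X → Bool) xs → length (filter (λ x → p x Bool.≟ true) xs) ≡ count p xs
  length-filter≡count p [] = refl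
  length-filter≡count p (x ∷ xs) with p x
  ... | true  = cong suc (length-filter≡count p xs)
  ... | false = length-filter≡count p xs

  sum-map-cong : ∀ {f g : X → ℕ} → (∀ x → f x ≡ g x) → ∀ xs → sum (map f xs) ≡ sum (map g xs)
  sum-map-cong f≗g xs = cong sum (map-cong f≗g xs)

  count-cong : ∀ {p q : X → Bool} → (∀ x → p x ≡ q x) → ∀ xs → count p xs ≡ count q xs
  count-cong p≗q = sum-map-cong (cong iverson ∘ p≗q)

  sum-map-zero : ∀ {f : X → ℕ} → (∀ x → f x ≡ 0) → ∀ xs → sum (map f xs) ≡ 0
  sum-map-zero f≗0 []       = refl
  sum-map-zero f≗0 (x ∷ xs) = cong₂ _+_ (f≗0 x) (sum-map-zero f≗0 xs)

  sum-map-+ : ∀ (f g : X → ℕ) xs → sum (map f xs) + sum (map g xs) ≡ sum (map (λ x → f x + g x) xs)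
  sum-map-+ f g []       = refl
  sum-map-+ f g (x ∷ xs) =
    trans (interchange (f x) _ (g x) _) (cong (f x + g x +_) (sum-map-+ f g xs))

  sum-map-concatMap : ∀ {Y : Set} (g : Y → ℕ) (f : X → List Y) xs →
                      sum (map g (concatMap f xs)) ≡ sum (map (λ x → sum (map g (f x))) xs)
  sum-map-concatMap g f []       = refl
  sum-map-concatMap g f (x ∷ xs) = begin
    sum (map g (f x ++ concatMap f xs))                   ≡⟨ cong sum (map-++ g (f x) _) ⟩
    sum (map g (f x) ++ map g (concatMap f xs))           ≡⟨ sum-++ (map g (f x)) _ ⟩
    sum (map g (f x)) + sum (map g (concatMap f xs))      ≡⟨ cong (sum (map g (f x)) +_) (sum-map-concatMap g f xs) ⟩
    sum (map g (f x)) + sum (map (λ x → sum (map g (f x))) xs) ∎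
    where open ≡-Reasoning

  count-map : ∀ {Y : Set} (p : Y → Bool) (f : X → Y) xs → count p (map f xs) ≡ count (p ∘ f) xs
  count-map p f xs = cong sum (sym (map-∘ xs))

  sum-map-if : ∀ (p q : X → Bool) (K : ℕ) (h : X → ℕ) xs →
    sum (map (λ x → if p x then (if q x then K else h x) else 0) xs)
      ≡ count (λ x → p x ∧ q x) xs * K + sum (map h (filter (λ x → (p x ∧ not (q x)) Bool.≟ true) xs))
  sum-map-if p q K h [] = refl
  sum-map-if p q K h (x ∷ xs) with p x | q x
  ... | false | _     = sum-map-if p q K h xs
  ... | true  | true  = trans (cong (K +_) (sum-map-if p q K h xs)) (sym (+-assoc K _ _))
  ... | true  | false = trans (cong (h x +_) (sum-map-if p q K h xs)) (x∙yz≈y∙xz (h x) (count (λ x → p x ∧ q x) xs * K) _)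

sum-tabulate-single : ∀ {n} (f : Fin n → ℕ) (v : Fin n) → (∀ x → x ≢ v → f x ≡ 0) → sum (tabulate f) ≡ f v
sum-tabulate-single f Fin.zero others = begin
  f Fin.zero + sum (tabulate (f ∘ Fin.suc))              ≡⟨ cong (λ xs → f Fin.zero + sum xs) (map-tabulate (λ x → x) (f ∘ Fin.suc)) ⟨
  f Fin.zero + sum (map (f ∘ Fin.suc) (allFin _))        ≡⟨ cong (f Fin.zero +_) (sum-map-zero (λ x → others (Fin.suc x) λ ()) (allFin _)) ⟩
  f Fin.zero + 0                                         ≡⟨ +-identityʳ _ ⟩
  f Fin.zero                                             ∎
  where open ≡-Reasoning
sum-tabulate-single f (Fin.suc v) others =
  trans (cong (_+ sum (tabulate (f ∘ Fin.suc))) (others Fin.zero λ ()))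
        (sum-tabulate-single (f ∘ Fin.suc) v λ x x≢v → others (Fin.suc x) (x≢v ∘ Fin.suc-injective))

sum-map-allFin-single : ∀ {n} (f : Fin n → ℕ) (v : Fin n) → (∀ x → x ≢ v → f x ≡ 0) → sum (map f (allFin n)) ≡ f v
sum-map-allFin-single f v others = trans (cong sum (map-tabulate (λ x → x) f)) (sum-tabulate-single f v others)

pred<⇒≤ : ∀ {v k} → 1 ≤ v → v ∸ 1 < k → v ≤ k
pred<⇒≤ {suc v} _ v≤k = v≤k

⌊⌋-true : ∀ {P : Set} (d : Dec P) → P → ⌊ d ⌋ ≡ true
⌊⌋-true d p = trans (isYes≗does d) (dec-true d p)

⌊⌋-false : ∀ {P : Set} (d : Dec P) → ¬ P → ⌊ d ⌋ ≡ false
⌊⌋-false d ¬p = trans (isYes≗does d) (dec-false d ¬p)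

⌊⌋≡true⇒ : ∀ {P : Set} (d : Dec P) → ⌊ d ⌋ ≡ true → P
⌊⌋≡true⇒ d h = toWitness (Equivalence.from T-≡ h)

iverson-≤?-split : ∀ lo n → iverson ⌊ lo ≤? n ⌋ ≡ iverson ⌊ n ≟ lo ⌋ + iverson ⌊ suc lo ≤? n ⌋
iverson-≤?-split lo n with <-cmp lo n
... | tri< lo<n lo≢n _
  rewrite ⌊⌋-true (lo ≤? n) (<⇒≤ lo<n) | ⌊⌋-false (n ≟ lo) (lo≢n ∘ sym) | ⌊⌋-true (suc lo ≤? n) lo<n = refl
... | tri≈ _ refl _
  rewrite ⌊⌋-true (lo ≤? lo) ≤-refl | ⌊⌋-true (lo ≟ lo) refl | ⌊⌋-false (suc lo ≤? lo) (n≮n lo) = refl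
... | tri> _ lo≢n n<lo
  rewrite ⌊⌋-false (lo ≤? n) (<⇒≱ n<lo) | ⌊⌋-false (n ≟ lo) (lo≢n ∘ sym) | ⌊⌋-false (suc lo ≤? n) (<⇒≱ n<lo ∘ <⇒≤) = refl

interval : ℕ → ℕ → List ℕ
interval lo n = map (lo +_) (upTo n)

interval-tail : ∀ lo n → map (lo +_) (applyUpTo suc n) ≡ interval (suc lo) n
interval-tail lo n = begin
  map (lo +_) (applyUpTo suc n)   ≡⟨ cong (map (lo +_)) (map-upTo suc n) ⟨
  map (lo +_) (map suc (upTo n))  ≡⟨ map-∘ (upTo n) ⟨
  map ((lo +_) ∘ suc) (upTo n)    ≡⟨ map-cong (+-suc lo) (upTo n) ⟩
  map (suc lo +_) (upTo n)        ∎
  where open ≡-Reasoning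

interval-suc : ∀ lo n → interval lo (suc n) ≡ lo ∷ interval (suc lo) n
interval-suc lo n = cong₂ _∷_ (+-identityʳ lo) (interval-tail lo n)

∈-range⁻ : ∀ lo hi {j} → j ∈ range lo hi → lo ≤ j × j ≤ hi
∈-range⁻ lo hi j∈ with ∈-map⁻ (lo +_) j∈
... | k , k∈ , refl = m≤m+n lo k , subst (_≤ hi) (+-comm k lo) (s≤s⁻¹ (m≤o∸n⇒m+n≤o (suc k) lo≤1+hi k<))
  where
  k< : k < suc hi ∸ lo
  k< = ∈-upTo⁻ k∈
  lo≤1+hi : lo ≤ suc hi
  lo≤1+hi = <⇒≤ (m∸n≢0⇒n<m (m<n⇒n≢0 k<))

∈-range⁺ : ∀ {lo hi j} → lo ≤ j → j ≤ hi → j ∈ range lo hi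
∈-range⁺ {lo} {hi} {j} lo≤j j≤hi =
  subst (_∈ range lo hi) (m+[n∸m]≡n lo≤j) (∈-map⁺ (lo +_) (∈-upTo⁺ (∸-monoˡ-< (s≤s j≤hi) lo≤j)))

module _ {X : Set} (p : X → Bool) where

  all-true⇒ : ∀ {xs x} → all p xs ≡ true → x ∈ xs → p x ≡ true
  all-true⇒ {y ∷ ys} h (here refl) = ∧-conicalˡ (p y) _ h
  all-true⇒ {y ∷ ys} h (there x∈) = all-true⇒ (∧-conicalʳ (p y) _ h) x∈

  all-false⇒ : ∀ {xs} → all p xs ≡ false → ∃[ x ] x ∈ xs × p x ≡ false
  all-false⇒ {y ∷ ys} h with p y in py
  ... | false = y , here refl , py
  ... | true with x , x∈ , px ← all-false⇒ h = x , there x∈ , px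

  any-false⇒ : ∀ {xs x} → any p xs ≡ false → x ∈ xs → p x ≡ false
  any-false⇒ {y ∷ ys} h (here refl) = ∨-conicalˡ (p y) _ h
  any-false⇒ {y ∷ ys} h (there x∈) = any-false⇒ (∨-conicalʳ (p y) _ h) x∈

  any-true⇒ : ∀ {xs} → any p xs ≡ true → ∃[ x ] x ∈ xs × p x ≡ true
  any-true⇒ {y ∷ ys} h with p y in py
  ... | true = y , here refl , py
  ... | false with x , x∈ , px ← any-true⇒ h = x , there x∈ , px

  filter-≡[]⇒ : ∀ {xs x} → filter (λ x → p x Bool.≟ true) xs ≡ [] → x ∈ xs → p x ≡ false
  filter-≡[]⇒ {xs} {x} h x∈ with p x in px
  ... | false = refl
  ... | true = contradiction (subst (x ∈_) h (∈-filter⁺ (λ x → p x Bool.≟ true) x∈ px)) λ ()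

  filter-≡∷⇒ : ∀ {xs t ts} → filter (λ x → p x Bool.≟ true) xs ≡ t ∷ ts → t ∈ xs × p t ≡ true
  filter-≡∷⇒ h = ∈-filter⁻ (λ x → p x Bool.≟ true) (subst (_ ∈_) (sym h) (here refl))

filter-interval-least : ∀ (p : ℕ → Bool) lo n {t ts} →
  filter (λ j → p j Bool.≟ true) (interval lo n) ≡ t ∷ ts → ∀ {j} → lo ≤ j → j < t → p j ≡ false
filter-interval-least p lo (suc n) {t} {ts} h {j} lo≤j j<t with p (lo + 0) in plo
... | true  = contradiction (subst (_≤ j) (trans (sym (+-identityʳ lo)) (∷-injectiveˡ h)) lo≤j) (<⇒≱ j<t)
... | false with m≤n⇒m<n∨m≡n lo≤j
...   | inj₁ lo<j = filter-interval-least p (suc lo) n (subst (λ l → filter _ l ≡ t ∷ ts) (interval-tail lo n) h) lo<j j<t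
...   | inj₂ refl = subst (λ k → p k ≡ false) (+-identityʳ lo) plo

module _ {X : Set} (p : X → Bool) (f : X → ℕ) (xs : List X) where

  private
    fibre : ℕ → ℕ
    fibre k = count (λ x → p x ∧ ⌊ f x ≟ k ⌋) xs

  count-atLeast≡sum-fibres-interval : ∀ lo n → (∀ x → p x ≡ true → f x < lo + n) →
    count (λ x → p x ∧ ⌊ lo ≤? f x ⌋) xs ≡ sum (map fibre (interval lo n))
  count-atLeast≡sum-fibres-interval lo zero bound = sum-map-zero none xs
    where
    none : ∀ x → iverson (p x ∧ ⌊ lo ≤? f x ⌋) ≡ 0
    none x with p x in px
    ... | false = refl
    ... | true rewrite ⌊⌋-false (lo ≤? f x) (<⇒≱ (subst (f x <_) (+-identityʳ lo) (bound x px))) = refl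
  count-atLeast≡sum-fibres-interval lo (suc n) bound = begin
    count (λ x → p x ∧ ⌊ lo ≤? f x ⌋) xs                                    ≡⟨ sum-map-cong split xs ⟩
    sum (map (λ x → iverson (p x ∧ ⌊ f x ≟ lo ⌋) + iverson (p x ∧ ⌊ suc lo ≤? f x ⌋)) xs)
                                                                            ≡⟨ sum-map-+ _ _ xs ⟨
    fibre lo + count (λ x → p x ∧ ⌊ suc lo ≤? f x ⌋) xs                     ≡⟨ cong (fibre lo +_) (count-atLeast≡sum-fibres-interval (suc lo) n bound′) ⟩
    fibre lo + sum (map fibre (interval (suc lo) n))                        ≡⟨ cong (sum ∘ map fibre) (interval-suc lo n) ⟨
    sum (map fibre (interval lo (suc n)))                                   ∎
    where
    open ≡-Reasoning
    split : ∀ x → iverson (p x ∧ ⌊ lo ≤? f x ⌋) ≡ iverson (p x ∧ ⌊ f x ≟ lo ⌋) + iverson (p x ∧ ⌊ suc lo ≤? f x ⌋)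
    split x with p x
    ... | true  = iverson-≤?-split lo (f x)
    ... | false = refl
    bound′ : ∀ x → p x ≡ true → f x < suc lo + n
    bound′ x px = subst (f x <_) (+-suc lo n) (bound x px)

  count-atLeast≡sum-fibres : ∀ lo hi → (∀ x → p x ≡ true → f x ≤ hi) →
    count (λ x → p x ∧ ⌊ lo ≤? f x ⌋) xs ≡ sum (map fibre (range lo hi))
  count-atLeast≡sum-fibres lo hi bound =
    count-atLeast≡sum-fibres-interval lo (suc hi ∸ lo) λ x px → <-≤-trans (s≤s (bound x px)) (m≤n+m∸n (suc hi) lo)

module _ {A : Set} where

  take-++ : ∀ n (xs ys : List A) → take n (xs ++ ys) ≡ take n xs ++ take (n ∸ length xs) ys
  take-++ zero    []       ys = refl
  take-++ zero    (x ∷ xs) ys = refl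
  take-++ (suc n) []       ys = refl
  take-++ (suc n) (x ∷ xs) ys = cong (x ∷_) (take-++ n xs ys)

  drop-++ : ∀ n (xs ys : List A) → drop n (xs ++ ys) ≡ drop n xs ++ drop (n ∸ length xs) ys
  drop-++ zero    []       ys = refl
  drop-++ zero    (x ∷ xs) ys = refl
  drop-++ (suc n) []       ys = refl
  drop-++ (suc n) (x ∷ xs) ys = drop-++ n xs ys

  length-take-≤ : ∀ n (xs : List A) → n ≤ length xs → length (take n xs) ≡ n
  length-take-≤ n xs n≤ = trans (length-take n xs) (m≤n⇒m⊓n≡m n≤)

  zipWith-++ : ∀ {B C : Set} (f : A → B → C) (xs : List A) (ys : List B) {xs′ ys′} → length xs ≡ length ys →
               zipWith f (xs ++ xs′) (ys ++ ys′) ≡ zipWith f xs ys ++ zipWith f xs′ ys′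
  zipWith-++ f []       []       _  = refl
  zipWith-++ f (x ∷ xs) (y ∷ ys) ∣xs∣≡∣ys∣ = cong (f x y ∷_) (zipWith-++ f xs ys (suc-injective ∣xs∣≡∣ys∣))

xor-cancelʳ : ∀ {n} (u v : Vec Bool n) → Vec.zipWith _xor_ (Vec.zipWith _xor_ u v) v ≡ u
xor-cancelʳ Vec.[]       Vec.[]       = refl
xor-cancelʳ (x Vec.∷ u) (y Vec.∷ v) =
  cong₂ Vec._∷_ (trans (xor-assoc x y y) (trans (cong (x xor_) (xor-same y)) (xor-identityʳ x))) (xor-cancelʳ u v)

thenCmp : Rel3 → Rel3 → Rel3
thenCmp lt _ = lt
thenCmp eq r = r
thenCmp gt _ = gt

∨-resolveˡ : ∀ {b c} → b ∨ c ≡ true → c ≡ false → b ≡ true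
∨-resolveˡ {true}  _    _ = refl
∨-resolveˡ {false} refl ()

isGt-thenCmp : ∀ {r} s → isGt r ≡ true → isGt (thenCmp r s) ≡ true
isGt-thenCmp {gt} _ _ = refl

isEq⇒≡eq : ∀ {r} → isEq r ≡ true → r ≡ eq
isEq⇒≡eq {eq} _ = refl

isLt⇒≡lt : ∀ {r} → isLt r ≡ true → r ≡ lt
isLt⇒≡lt {lt} _ = refl

module AntemerTheory (b : ℕ) (enc : Fin (2 ^ b) ↔ Vec Bool b) {m : ℕ} (wv γv : Vec (Fin (2 ^ b)) m) where

  open Antemer b enc wv γv

  ⊕-cancelʳ : ∀ {x y z} → x ⊕ z ≡ y ⊕ z → x ≡ y
  ⊕-cancelʳ {x} {y} {z} e = trans (sym (unshift x)) (trans (cong (λ u → from (Vec.zipWith _xor_ (to u) (to z))) e) (unshift y))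
    where
    open Inverse enc using (to; from; strictlyInverseˡ; strictlyInverseʳ)
    unshift : ∀ u → from (Vec.zipWith _xor_ (to (u ⊕ z)) (to z)) ≡ u
    unshift u = begin
      from (Vec.zipWith _xor_ (to (u ⊕ z)) (to z))                          ≡⟨ cong (λ v → from (Vec.zipWith _xor_ v (to z))) (strictlyInverseˡ _) ⟩
      from (Vec.zipWith _xor_ (Vec.zipWith _xor_ (to u) (to z)) (to z))     ≡⟨ cong from (xor-cancelʳ (to u) (to z)) ⟩
      from (to u)                                                           ≡⟨ strictlyInverseʳ u ⟩
      u                                                                     ∎
      where open ≡-Reasoning

  ==-refl : ∀ x → (x == x) ≡ true
  ==-refl x = ⌊⌋-true (x Fin.≟ x) refl

  ==-false : ∀ {x y} → x ≢ y → (x == y) ≡ false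
  ==-false {x} {y} = ⌊⌋-false (x Fin.≟ y)

  ==≡false⇒≢ : ∀ {x y} → (x == y) ≡ false → x ≢ y
  ==≡false⇒≢ {x} x≠y refl = case trans (sym x≠y) (==-refl x) of λ ()

  ==⇒≡ : ∀ {x y} → (x == y) ≡ true → x ≡ y
  ==⇒≡ {x} {y} h with x Fin.≟ y
  ==⇒≡ _  | yes x≡y = x≡y
  ==⇒≡ () | no _

  cmpL-refl : ∀ x → cmpL x x ≡ eq
  cmpL-refl x with Fin.<-cmp x x
  ... | tri< x<x _ _ = contradiction x<x (Fin.<-irrefl refl)
  ... | tri≈ _ _ _   = refl
  ... | tri> _ _ x>x = contradiction x>x (Fin.<-irrefl refl)

  cmpL≡eq⇒≡ : ∀ {x y} → cmpL x y ≡ eq → x ≡ y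
  cmpL≡eq⇒≡ {x} {y} h with Fin.<-cmp x y
  cmpL≡eq⇒≡ () | tri< _ _ _
  cmpL≡eq⇒≡ _  | tri≈ _ x≡y _ = x≡y
  cmpL≡eq⇒≡ () | tri> _ _ _

  lexCmp-∷ : ∀ x y u v → lexCmp (x ∷ u) (y ∷ v) ≡ thenCmp (cmpL x y) (lexCmp u v)
  lexCmp-∷ x y u v with cmpL x y
  ... | lt = refl
  ... | eq = refl
  ... | gt = refl

  lexCmp-refl : ∀ u → lexCmp u u ≡ eq
  lexCmp-refl []      = refl
  lexCmp-refl (x ∷ u) = trans (lexCmp-∷ x x u u) (trans (cong (λ r → thenCmp r (lexCmp u u)) (cmpL-refl x)) (lexCmp-refl u))

  lexCmp-++ : ∀ u v {s t} → length u ≡ length v → lexCmp (u ++ s) (v ++ t) ≡ thenCmp (lexCmp u v) (lexCmp s t)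
  lexCmp-++ []      []      _ = refl
  lexCmp-++ (x ∷ u) (y ∷ v) {s} {t} ∣u∣≡∣v∣
    rewrite lexCmp-∷ x y (u ++ s) (v ++ t) | lexCmp-∷ x y u v with cmpL x y
  ... | lt = refl
  ... | eq = lexCmp-++ u v (suc-injective ∣u∣≡∣v∣)
  ... | gt = refl

  length-⊕w : ∀ u v g → length u ≡ length v → length (u ⊕w g) ≡ length (v ⊕w g)
  length-⊕w u v g ∣u∣≡∣v∣ =
    trans (length-zipWith _⊕_ u g) (trans (cong (_⊓ length g) ∣u∣≡∣v∣) (sym (length-zipWith _⊕_ v g)))

  lexCmp-⊕w-eq⇒≡ : ∀ u v g → length u ≡ length g → length v ≡ length g → lexCmp (u ⊕w g) (v ⊕w g) ≡ eq → u ≡ v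
  lexCmp-⊕w-eq⇒≡ []      []      []      _ _ _ = refl
  lexCmp-⊕w-eq⇒≡ (x ∷ u) (y ∷ v) (z ∷ g) ∣u∣ ∣v∣ h
    rewrite lexCmp-∷ (x ⊕ z) (y ⊕ z) (u ⊕w g) (v ⊕w g) with cmpL (x ⊕ z) (y ⊕ z) in xz≟yz
  ... | eq = cong₂ _∷_ (⊕-cancelʳ (cmpL≡eq⇒≡ xz≟yz)) (lexCmp-⊕w-eq⇒≡ u v g (suc-injective ∣u∣) (suc-injective ∣v∣) h)

  length-w : length w ≡ m
  length-w = Vec.length-toList wv

  length-γ : length γ ≡ m
  length-γ = Vec.length-toList γv

  drop-at : ∀ (xs : List L) n → n < length xs → drop n xs ≡ at xs (suc n) ∷ drop (suc n) xs
  drop-at (x ∷ xs) zero    _   = refl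
  drop-at (x ∷ xs) (suc n) n<∣xs∣ = drop-at xs n (s≤s⁻¹ n<∣xs∣)

  take-at : ∀ (xs : List L) n z → n < length xs → take n xs ++ at xs (suc n) ∷ z ≡ take (suc n) xs ++ z
  take-at (x ∷ xs) zero    z _   = refl
  take-at (x ∷ xs) (suc n) z n<∣xs∣ = cong (x ∷_) (take-at xs n z (s≤s⁻¹ n<∣xs∣))

  merCmp : List L → ℕ → Rel3
  merCmp s p = lexCmp (take m (drop p s) ⊕w γ) (w ⊕w γ)

  letterCmp : ℕ → L → Rel3
  letterCmp k x = cmpL (x ⊕ c k) (a k ⊕ c k)

  suffixCmp : ℕ → List L → Rel3
  suffixCmp n t = lexCmp (take (m ∸ n) t ⊕w drop n γ) (drop n w ⊕w drop n γ)

  suffixCmp-∷ : ∀ {n} x t → n < m → suffixCmp n (x ∷ t) ≡ thenCmp (letterCmp (suc n) x) (suffixCmp (suc n) t)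
  suffixCmp-∷ {n} x t n<m
    rewrite +-∸-assoc 1 n<m | drop-at γ n (subst (n <_) (sym length-γ) n<m) | drop-at w n (subst (n <_) (sym length-w) n<m) =
    lexCmp-∷ (x ⊕ c (suc n)) (a (suc n) ⊕ c (suc n)) _ _

  suffixCmp-m : ∀ t → suffixCmp m t ≡ eq
  suffixCmp-m t = cong (λ k → lexCmp (take k t ⊕w drop m γ) (drop m w ⊕w drop m γ)) (n∸n≡0 m)

  merCmp-prefix : ∀ {i p} t → i ≤ m → p ≤ i → merCmp (take i w ++ t) p ≡ thenCmp (R i (suc p)) (suffixCmp (i ∸ p) t)
  merCmp-prefix {i} {p} t i≤m p≤i = begin
    lexCmp (take m (drop p (take i w ++ t)) ⊕w γ) (w ⊕w γ)
      ≡⟨ cong (λ s → lexCmp (take m s ⊕w γ) (w ⊕w γ)) drop-p ⟩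
    lexCmp (take m (u ++ t) ⊕w γ) (w ⊕w γ)
      ≡⟨ cong (λ s → lexCmp (s ⊕w γ) (w ⊕w γ)) take-m ⟩
    lexCmp ((u ++ t′) ⊕w γ) (w ⊕w γ)
      ≡⟨ cong₂ (λ g v → lexCmp ((u ++ t′) ⊕w g) (v ⊕w g)) (take++drop≡id n γ) (take++drop≡id n w) ⟨
    lexCmp ((u ++ t′) ⊕w (take n γ ++ drop n γ)) ((take n w ++ drop n w) ⊕w (take n γ ++ drop n γ))
      ≡⟨ cong₂ lexCmp (zipWith-++ _⊕_ u (take n γ) (trans ∣u∣ (sym ∣γₙ∣))) (zipWith-++ _⊕_ (take n w) (take n γ) (trans ∣wₙ∣ (sym ∣γₙ∣))) ⟩
    lexCmp ((u ⊕w take n γ) ++ (t′ ⊕w drop n γ)) ((take n w ⊕w take n γ) ++ (drop n w ⊕w drop n γ))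
      ≡⟨ lexCmp-++ (u ⊕w take n γ) (take n w ⊕w take n γ) (length-⊕w u (take n w) (take n γ) (trans ∣u∣ (sym ∣wₙ∣))) ⟩
    thenCmp (R i (suc p)) (suffixCmp n t) ∎
    where
    open ≡-Reasoning
    n : ℕ
    n = i ∸ p
    u t′ : List L
    u = take n (drop p w)
    t′ = take (m ∸ n) t
    n≤m : n ≤ m
    n≤m = ≤-trans (m∸n≤m i p) i≤m
    ∣u∣ : length u ≡ n
    ∣u∣ = length-take-≤ n (drop p w) (subst (n ≤_) (sym (trans (length-drop p w) (cong (_∸ p) length-w))) (∸-monoˡ-≤ p i≤m))
    ∣wₙ∣ : length (take n w) ≡ n
    ∣wₙ∣ = length-take-≤ n w (subst (n ≤_) (sym length-w) n≤m)
    ∣γₙ∣ : length (take n γ) ≡ n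
    ∣γₙ∣ = length-take-≤ n γ (subst (n ≤_) (sym length-γ) n≤m)
    drop-p : drop p (take i w ++ t) ≡ u ++ t
    drop-p = begin
      drop p (take i w ++ t)                              ≡⟨ drop-++ p (take i w) t ⟩
      drop p (take i w) ++ drop (p ∸ length (take i w)) t ≡⟨ cong (λ k → drop p (take i w) ++ drop k t) p∸i≡0 ⟩
      drop p (take i w) ++ t                              ≡⟨ cong (λ v → drop p (take v w) ++ t) (m+[n∸m]≡n p≤i) ⟨
      drop p (take (p + n) w) ++ t                        ≡⟨ cong (_++ t) (take-drop n p w) ⟨
      u ++ t                                              ∎
      where
      p∸i≡0 : p ∸ length (take i w) ≡ 0
      p∸i≡0 = m≤n⇒m∸n≡0 (subst (p ≤_) (sym (length-take-≤ i w (subst (i ≤_) (sym length-w) i≤m))) p≤i)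
    take-m : take m (u ++ t) ≡ u ++ t′
    take-m = trans (take-++ m u t) (cong₂ (λ v k → v ++ take (m ∸ k) t) (take-all m u (subst (_≤ m) (sym ∣u∣) n≤m)) ∣u∣)

  merCmp-prefix-∷ : ∀ {i p} x t → i < m → p ≤ i →
    merCmp (take i w ++ x ∷ t) p ≡ thenCmp (R i (suc p)) (thenCmp (letterCmp (suc i ∸ p) x) (suffixCmp (suc i ∸ p) t))
  merCmp-prefix-∷ {i} {p} x t i<m p≤i = begin
    merCmp (take i w ++ x ∷ t) p                                                      ≡⟨ merCmp-prefix (x ∷ t) (<⇒≤ i<m) p≤i ⟩
    thenCmp (R i (suc p)) (suffixCmp (i ∸ p) (x ∷ t))                                 ≡⟨ cong (thenCmp (R i (suc p))) (suffixCmp-∷ x t (≤-<-trans (m∸n≤m i p) i<m)) ⟩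
    thenCmp (R i (suc p)) (thenCmp (letterCmp (suc (i ∸ p)) x) (suffixCmp (suc (i ∸ p)) t))
                                                                                      ≡⟨ cong (λ k → thenCmp (R i (suc p)) (thenCmp (letterCmp k x) (suffixCmp k t))) (+-∸-assoc 1 p≤i) ⟨
    thenCmp (R i (suc p)) (thenCmp (letterCmp (suc i ∸ p) x) (suffixCmp (suc i ∸ p) t)) ∎
    where open ≡-Reasoning

  isAntemer-∷ : ∀ x y → isAntemer (x ∷ y) ≡ isGt (merCmp (x ∷ y ++ w) 0) ∧ isAntemer y
  isAntemer-∷ x y = cong (isGt (merCmp (x ∷ y ++ w) 0) ∧_)
    (cong and (trans (map-applyUpTo suc (λ p → isGt (merCmp (x ∷ y ++ w) p)) (length y)) (sym (map-upTo _ (length y)))))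

  isAntemer⇒ : ∀ {y p} → isAntemer y ≡ true → p < length y → isGt (merCmp (y ++ w) p) ≡ true
  isAntemer⇒ {y} ante p<∣y∣ = all-true⇒ (λ p → isGt (merCmp (y ++ w) p)) ante (∈-upTo⁺ p<∣y∣)

  isAntemer-drop : ∀ y d → d ≤ length y → (∀ p → p < d → isGt (merCmp (y ++ w) p) ≡ true) → isAntemer y ≡ isAntemer (drop d y)
  isAntemer-drop y       zero    _       _    = refl
  isAntemer-drop (x ∷ y) (suc d) d≤∣y∣ good rewrite isAntemer-∷ x y | good 0 z<s =
    isAntemer-drop y d (s≤s⁻¹ d≤∣y∣) (λ p p<d → good (suc p) (s≤s p<d))

  count-words-suc : ∀ (q : List L → Bool) n → count q (words (suc n)) ≡ sum (map (λ x → count (q ∘ (x ∷_)) (words n)) (allFin (2 ^ b)))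
  count-words-suc q n =
    trans (sum-map-concatMap (iverson ∘ q) (λ x → map (x ∷_) (words n)) (allFin _)) (sum-map-cong (λ x → count-map q (x ∷_) (words n)) (allFin _))

  count-words-prefix : ∀ u r (q : List L → Bool) → (∀ y → q y ≡ true → take (length u) y ≡ u) →
    count q (words (length u + r)) ≡ count (q ∘ (u ++_)) (words r)
  count-words-prefix []       r q _      = refl
  count-words-prefix (u₀ ∷ u) r q prefix = begin
    count q (words (suc (length u + r)))                                    ≡⟨ count-words-suc q (length u + r) ⟩
    sum (map (λ x → count (q ∘ (x ∷_)) (words (length u + r))) (allFin _))  ≡⟨ sum-map-allFin-single _ u₀ others ⟩
    count (q ∘ (u₀ ∷_)) (words (length u + r))                              ≡⟨ count-words-prefix u r (q ∘ (u₀ ∷_)) (λ y → ∷-injectiveʳ ∘ prefix (u₀ ∷ y)) ⟩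
    count (q ∘ (u₀ ∷_) ∘ (u ++_)) (words r)                                 ∎
    where
    open ≡-Reasoning
    others : ∀ x → x ≢ u₀ → count (q ∘ (x ∷_)) (words (length u + r)) ≡ 0
    others x x≢u₀ = sum-map-zero (cong iverson ∘ reject) (words (length u + r))
      where
      reject : ∀ y → q (x ∷ y) ≡ false
      reject y with q (x ∷ y) in qxy
      ... | false = refl
      ... | true  = contradiction (∷-injectiveˡ (prefix (x ∷ y) qxy)) x≢u₀

  lcp-take : ∀ s (y v : List L) → s ≤ lcp y v → take s y ≡ take s v
  lcp-take zero    y       v        _ = refl
  lcp-take (suc s) (x ∷ y) (x′ ∷ v) s<lcp with x Fin.≟ x′
  ... | yes refl = cong (x ∷_) (lcp-take s y v (s≤s⁻¹ s<lcp))

  lcp≤length : ∀ (y v : List L) → lcp y v ≤ length y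
  lcp≤length []      v        = z≤n
  lcp≤length (x ∷ y) []       = z≤n
  lcp≤length (x ∷ y) (x′ ∷ v) with x Fin.≟ x′
  ... | yes _ = s≤s (lcp≤length y v)
  ... | no _  = z≤n

  lcp-take-++ : ∀ i (xs v : List L) → i ≤ length xs → lcp (take i xs ++ v) xs ≡ i + lcp v (drop i xs)
  lcp-take-++ zero    xs       v _ = refl
  lcp-take-++ (suc i) (x ∷ xs) v i<∣xs∣ rewrite ==-refl x = cong suc (lcp-take-++ i xs v (s≤s⁻¹ i<∣xs∣))

  ++w-split : ∀ {v} y → take v y ≡ take v w → y ++ w ≡ take v w ++ (drop v y ++ w)
  ++w-split {v} y agree = begin
    y ++ w                        ≡⟨ cong (_++ w) (take++drop≡id v y) ⟨
    (take v y ++ drop v y) ++ w   ≡⟨ ++-assoc (take v y) (drop v y) w ⟩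
    take v y ++ (drop v y ++ w)   ≡⟨ cong (_++ (drop v y ++ w)) agree ⟩
    take v w ++ (drop v y ++ w)   ∎
    where open ≡-Reasoning

  badRows : List ℕ
  badRows = filter (λ i → badRow i Bool.≟ true) (range 2 (m ∸ 1))

  firstBadRow : ℕ
  firstBadRow = foldr _⊓_ m badRows

  firstBadRow≤m : firstBadRow ≤ m
  firstBadRow≤m = foldr-preservesʳ {P = _≤ m} (λ x → m≤n⇒o⊓m≤n x) ≤-refl badRows

  firstBadRow≤ : ∀ {i} → 2 ≤ i → i < m → badRow i ≡ true → firstBadRow ≤ i
  firstBadRow≤ {i} 2≤i i<m bad =
    foldr-preservesᵒ {P = _≤ i} (λ x y → [ m≤n⇒m⊓o≤n y , m≤n⇒o⊓m≤n x ]) m badRows (inj₂ (Any.map (≤-reflexive ∘ sym) i∈))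
    where
    i∈ : i ∈ badRows
    i∈ = ∈-filter⁺ (λ i → badRow i Bool.≟ true) (∈-range⁺ 2≤i (∸-monoˡ-≤ 1 i<m)) bad

  firstBadRow-sel : firstBadRow ≡ m ⊎ (2 ≤ firstBadRow × badRow firstBadRow ≡ true)
  firstBadRow-sel with foldr-selective {_•_ = _⊓_} ⊓-sel m badRows
  ... | inj₁ ≡m = inj₁ ≡m
  ... | inj₂ ∈bad with ∈r , bad ← ∈-filter⁻ (λ i → badRow i Bool.≟ true) {xs = range 2 (m ∸ 1)} ∈bad =
    inj₂ (proj₁ (∈-range⁻ 2 (m ∸ 1) ∈r) , bad)

  imax<m : 1 ≤ m → imax < m
  imax<m 1≤m = ≤-<-trans (∸-monoˡ-≤ 1 firstBadRow≤m) (∸-monoʳ-< z<s 1≤m)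

  badRow-false : 1 ≤ m → ∀ {i} → i ≤ imax → badRow i ≡ false
  badRow-false 1≤m {i} i≤imax with badRow i in bad
  ... | false = refl
  ... | true with j , j∈ , _ ← any-true⇒ (λ j → isLt (R i j)) {range 2 i} bad = contradiction i≤imax (<⇒≱ imax<i)
    where
    2≤i : 2 ≤ i
    2≤i = uncurry ≤-trans (∈-range⁻ 2 i j∈)
    imax<i : imax < i
    imax<i = ≤-<-trans (∸-monoˡ-≤ 1 (firstBadRow≤ 2≤i (≤-<-trans i≤imax (imax<m 1≤m)) bad))
                       (∸-monoʳ-< z<s (≤-trans (s≤s z≤n) 2≤i))

  R-first : ∀ i → R i 1 ≡ eq
  R-first i = lexCmp-refl (take i w ⊕w take i γ)

  R-diag : ∀ i → R i (suc i) ≡ eq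
  R-diag i = cong (λ k → lexCmp (take k (drop i w) ⊕w take k γ) (take k w ⊕w take k γ)) (n∸n≡0 i)

  antemer-prefix : ∀ {y v p} → isAntemer y ≡ true → v ≤ m → v ≤ lcp y w → p < v →
    isGt (thenCmp (R v (suc p)) (suffixCmp (v ∸ p) (drop v y ++ w))) ≡ true
  antemer-prefix {y} {v} {p} ante v≤m v≤lcp p<v = begin
    isGt (thenCmp (R v (suc p)) (suffixCmp (v ∸ p) (drop v y ++ w))) ≡⟨ cong isGt (merCmp-prefix (drop v y ++ w) v≤m (<⇒≤ p<v)) ⟨
    isGt (merCmp (take v w ++ (drop v y ++ w)) p)                    ≡⟨ cong (λ s → isGt (merCmp s p)) (++w-split y (lcp-take v y w v≤lcp)) ⟨
    isGt (merCmp (y ++ w) p)                                         ≡⟨ isAntemer⇒ ante (<-≤-trans p<v (≤-trans v≤lcp (lcp≤length y w))) ⟩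
    true                                                             ∎
    where open ≡-Reasoning

  -- If lcp y w > imax, y starts with a₁⋯a_v for v = imax + 1, which is m (so the m-mer at 0
  -- equals w) or a row with an entry R v (p + 1) = lt (so the m-mer at p is smaller).
  lcp≤imax : 1 ≤ m → ∀ y → isAntemer y ≡ true → lcp y w ≤ imax
  lcp≤imax 1≤m y ante with lcp y w ≤? imax
  ... | yes ≤imax = ≤imax
  ... | no ≰imax with firstBadRow-sel
  ...   | inj₁ v≡m = case trans (sym (antemer-prefix {y} ante ≤-refl m≤lcp 1≤m)) not-gt of λ ()
    where
    m≤lcp : m ≤ lcp y w
    m≤lcp = subst (_≤ lcp y w) v≡m (pred<⇒≤ (subst (1 ≤_) (sym v≡m) 1≤m) (≰⇒> ≰imax))
    not-gt : isGt (thenCmp (R m 1) (suffixCmp m (drop m y ++ w))) ≡ false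
    not-gt = cong isGt (cong₂ thenCmp (R-first m) (suffixCmp-m (drop m y ++ w)))
  ...   | inj₂ (2≤v , bad) with any-true⇒ (λ j → isLt (R firstBadRow j)) {range 2 firstBadRow} bad
  ...     | zero  , 0∈ , _       = contradiction (proj₁ (∈-range⁻ 2 firstBadRow 0∈)) λ ()
  ...     | suc p , p+1∈ , lt-at = case trans (sym (antemer-prefix {y} ante firstBadRow≤m v≤lcp p<v)) not-gt of λ ()
    where
    v≤lcp : firstBadRow ≤ lcp y w
    v≤lcp = pred<⇒≤ (≤-trans (s≤s z≤n) 2≤v) (≰⇒> ≰imax)
    p<v : p < firstBadRow
    p<v = proj₂ (∈-range⁻ 2 firstBadRow p+1∈)
    not-gt : isGt (thenCmp (R firstBadRow (suc p)) (suffixCmp (firstBadRow ∸ p) (drop firstBadRow y ++ w))) ≡ false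
    not-gt = cong (λ r → isGt (thenCmp r (suffixCmp (firstBadRow ∸ p) (drop firstBadRow y ++ w)))) (isLt⇒≡lt lt-at)

  R≡eq⇒border : ∀ {i d} → i ≤ m → d ≤ i → R i (suc d) ≡ eq → drop d (take i w) ≡ take (i ∸ d) w
  R≡eq⇒border {i} {d} i≤m d≤i R≡eq = begin
    drop d (take i w)           ≡⟨ cong (λ k → drop d (take k w)) (m+[n∸m]≡n d≤i) ⟨
    drop d (take (d + n) w)     ≡⟨ take-drop n d w ⟨
    take n (drop d w)           ≡⟨ lexCmp-⊕w-eq⇒≡ (take n (drop d w)) (take n w) (take n γ) (trans ∣u∣ (sym ∣γₙ∣)) (trans ∣wₙ∣ (sym ∣γₙ∣)) R≡eq ⟩
    take n w                    ∎
    where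
    open ≡-Reasoning
    n : ℕ
    n = i ∸ d
    n≤m : n ≤ m
    n≤m = ≤-trans (m∸n≤m i d) i≤m
    ∣u∣ : length (take n (drop d w)) ≡ n
    ∣u∣ = length-take-≤ n (drop d w) (subst (n ≤_) (sym (trans (length-drop d w) (cong (_∸ d) length-w))) (∸-monoˡ-≤ d i≤m))
    ∣wₙ∣ : length (take n w) ≡ n
    ∣wₙ∣ = length-take-≤ n w (subst (n ≤_) (sym length-w) n≤m)
    ∣γₙ∣ : length (take n γ) ≡ n
    ∣γₙ∣ = length-take-≤ n γ (subst (n ≤_) (sym length-γ) n≤m)

  isAntemer-fails : ∀ {y p} → p < length y → isGt (merCmp (y ++ w) p) ≡ false → isAntemer y ≡ false
  isAntemer-fails {y} p<∣y∣ bad with isAntemer y in ante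
  ... | false = refl
  ... | true  = contradiction (trans (sym bad) (isAntemer⇒ ante p<∣y∣)) λ ()

  inΣ⇒≢ : ∀ {k x} → inΣ k x ≡ true → x ≢ a k
  inΣ⇒≢ {k} σ refl = case trans (sym σ) (cong isGt (cmpL-refl (a k ⊕ c k))) of λ ()

  count-antemers-with-prefix : 1 ≤ m → ∀ {s} r → s ≤ m →
    count (λ z → isAntemer (take s w ++ z)) (words r) ≡ sum (map (λ i′ → Ai i′ (s + r)) (range s imax))
  count-antemers-with-prefix 1≤m {s} r s≤m = begin
    count (isAntemer ∘ (take s w ++_)) (words r)                  ≡⟨ count-cong extends-prefix (words r) ⟨
    count (q ∘ (take s w ++_)) (words r)                          ≡⟨ count-words-prefix (take s w) r q prefix ⟨
    count q (words (length (take s w) + r))                       ≡⟨ cong (λ n → count q (words (n + r))) ∣wₛ∣ ⟩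
    count q (words (s + r))                                       ≡⟨ count-atLeast≡sum-fibres isAntemer (λ y → lcp y w) (words (s + r)) s imax (lcp≤imax 1≤m) ⟩
    sum (map (λ k → count (λ y → isAntemer y ∧ ⌊ lcp y w ≟ k ⌋) (words (s + r))) (range s imax))
                                                                  ≡⟨ sum-map-cong (λ k → length-filter≡count _ (words (s + r))) (range s imax) ⟨
    sum (map (λ i′ → Ai i′ (s + r)) (range s imax))               ∎
    where
    open ≡-Reasoning
    q : List L → Bool
    q y = isAntemer y ∧ ⌊ s ≤? lcp y w ⌋
    ∣wₛ∣ : length (take s w) ≡ s
    ∣wₛ∣ = length-take-≤ s w (subst (s ≤_) (sym length-w) s≤m)
    prefix : ∀ y → q y ≡ true → take (length (take s w)) y ≡ take s w
    prefix y qy = subst (λ n → take n y ≡ take s w) (sym ∣wₛ∣)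
                        (lcp-take s y w (⌊⌋≡true⇒ (s ≤? lcp y w) (∧-conicalʳ (isAntemer y) _ qy)))
    extends-prefix : ∀ z → q (take s w ++ z) ≡ isAntemer (take s w ++ z)
    extends-prefix z = trans (cong (isAntemer (take s w ++ z) ∧_) (⌊⌋-true (s ≤? _) s≤lcp)) (∧-identityʳ _)
      where
      s≤lcp : s ≤ lcp (take s w ++ z) w
      s≤lcp = subst (s ≤_) (sym (lcp-take-++ s w z (subst (s ≤_) (sym length-w) s≤m))) (m≤m+n s _)

  module Row (1≤m : 1 ≤ m) {i : ℕ} (i≤imax : i ≤ imax) where

    i<m : i < m
    i<m = ≤-<-trans i≤imax (imax<m 1≤m)

    1+i∸i≡1 : suc i ∸ i ≡ 1
    1+i∸i≡1 = m+n∸n≡m 1 i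

    R≢lt : ∀ {p} → p ≤ i → R i (suc p) ≢ lt
    R≢lt {zero} _ R≡lt = case trans (sym (R-first i)) R≡lt of λ ()
    R≢lt {suc p} p<i R≡lt with m≤n⇒m<n∨m≡n p<i
    ... | inj₂ refl = case trans (sym (R-diag i)) R≡lt of λ ()
    ... | inj₁ p+1<i = case trans (sym not-lt) (cong isLt R≡lt) of λ ()
      where
      not-lt : isLt (R i (suc (suc p))) ≡ false
      not-lt = any-false⇒ (λ j → isLt (R i j)) {range 2 i} (badRow-false 1≤m i≤imax) (∈-range⁺ (s≤s (s≤s z≤n)) p+1<i)

    Y : L → List L → List L
    Y x z = take i w ++ x ∷ z

    ∣wᵢ∣ : length (take i w) ≡ i
    ∣wᵢ∣ = length-take-≤ i w (subst (i ≤_) (sym length-w) (<⇒≤ i<m))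

    length-Y : ∀ x z → length (Y x z) ≡ suc (i + length z)
    length-Y x z = trans (length-++ (take i w)) (trans (cong (_+ suc (length z)) ∣wᵢ∣) (+-suc i (length z)))

    merCmp-Y : ∀ x z {p} → p ≤ i →
      merCmp (Y x z ++ w) p ≡ thenCmp (R i (suc p)) (thenCmp (letterCmp (suc i ∸ p) x) (suffixCmp (suc i ∸ p) (z ++ w)))
    merCmp-Y x z {p} p≤i = trans (cong (λ s → merCmp s p) (++-assoc (take i w) (x ∷ z) w)) (merCmp-prefix-∷ x (z ++ w) i<m p≤i)

    Y-exceeds : ∀ x z {p} → p ≤ i → R i (suc p) ≡ gt ⊎ (R i (suc p) ≡ eq × inΣ (suc i ∸ p) x ≡ true) →
             isGt (merCmp (Y x z ++ w) p) ≡ true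
    Y-exceeds x z p≤i (inj₁ R≡gt) rewrite merCmp-Y x z p≤i | R≡gt = refl
    Y-exceeds x z {p} p≤i (inj₂ (R≡eq , σ)) rewrite merCmp-Y x z p≤i | R≡eq = isGt-thenCmp (suffixCmp (suc i ∸ p) (z ++ w)) σ

    Y-not-exceeds : ∀ x z {p} → p ≤ i → R i (suc p) ≡ eq → inΣ (suc i ∸ p) x ≡ false → x ≢ a (suc i ∸ p) →
            isGt (merCmp (Y x z ++ w) p) ≡ false
    Y-not-exceeds x z {p} p≤i R≡eq ¬σ x≢a rewrite merCmp-Y x z p≤i | R≡eq with letterCmp (suc i ∸ p) x in x≟a
    ... | lt = refl
    ... | eq = contradiction (⊕-cancelʳ (cmpL≡eq⇒≡ x≟a)) x≢a
    ... | gt = case ¬σ of λ ()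

    Admissible : L → ℕ → Bool
    Admissible x j = not (isEq (R i j)) ∨ inΣ (suc (suc i) ∸ j) x ∨ (x == a (suc (suc i) ∸ j))

    ΣA-parts : ∀ {x} → inΣA i x ≡ true →
               inΣ (suc i) x ≡ true × (inΣ 1 x ∨ (x == a 1)) ≡ true × all (Admissible x) (range 2 i) ≡ true
    ΣA-parts {x} σA = ∧-conicalˡ first rest σA , ∧-conicalˡ second third rest≡ , ∧-conicalʳ second third rest≡
      where
      first second third rest : Bool
      first = inΣ (suc i) x
      second = inΣ 1 x ∨ (x == a 1)
      third = all (Admissible x) (range 2 i)
      rest = second ∧ third
      rest≡ : rest ≡ true
      rest≡ = ∧-conicalʳ first rest σA

    ΣA-later : ∀ {x p} → inΣA i x ≡ true → 1 ≤ p → p ≤ i → R i (suc p) ≡ eq →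
               (inΣ (suc i ∸ p) x ∨ (x == a (suc i ∸ p))) ≡ true
    ΣA-later {x} {p} σA 1≤p p≤i R≡eq with m≤n⇒m<n∨m≡n p≤i | ΣA-parts σA
    ... | inj₂ refl | _ , second , _ = subst (λ k → (inΣ k x ∨ (x == a k)) ≡ true) (sym 1+i∸i≡1) second
    ... | inj₁ p<i  | _ , _ , third  = subst (λ r → (not (isEq r) ∨ inΣ (suc i ∸ p) x ∨ (x == a (suc i ∸ p))) ≡ true) R≡eq
                                         (all-true⇒ (Admissible x) {range 2 i} third (∈-range⁺ (s≤s 1≤p) p<i))

    ΣA-fails : ∀ {x} → inΣA i x ≡ false → x ≢ a (suc i) →
               ∃[ p ] p ≤ i × R i (suc p) ≡ eq × inΣ (suc i ∸ p) x ≡ false × (x == a (suc i ∸ p)) ≡ false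
    ΣA-fails {x} ¬σA x≢a with inΣ (suc i) x in σ₁ | inΣ 1 x ∨ (x == a 1) in σ₂ | all (Admissible x) (range 2 i) in σ₃
    ... | false | _     | _     = 0 , z≤n , R-first i , σ₁ , ==-false x≢a
    ... | true  | false | _     = i , ≤-refl , R-diag i ,
          subst (λ k → inΣ k x ≡ false) (sym 1+i∸i≡1) (∨-conicalˡ _ _ σ₂) , subst (λ k → (x == a k) ≡ false) (sym 1+i∸i≡1) (∨-conicalʳ _ _ σ₂)
    ... | true  | true  | false with all-false⇒ (Admissible x) {range 2 i} σ₃
    ...   | zero , 0∈ , _ = contradiction (proj₁ (∈-range⁻ 2 i 0∈)) λ ()
    ...   | suc p , p+1∈ , inadmissible =
          p , <⇒≤ (proj₂ (∈-range⁻ 2 i p+1∈)) , isEq⇒≡eq (not-injective (∨-conicalˡ notEq rest inadmissible)) ,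
          ∨-conicalˡ σ isA (∨-conicalʳ notEq rest inadmissible) , ∨-conicalʳ σ isA (∨-conicalʳ notEq rest inadmissible)
      where
      notEq σ isA rest : Bool
      notEq = not (isEq (R i (suc p)))
      σ = inΣ (suc i ∸ p) x
      isA = x == a (suc i ∸ p)
      rest = σ ∨ isA

    Match : L → ℕ → Bool
    Match x j = isEq (R i j) ∧ (a (suc (suc i) ∸ j) == x)

    Match-false⇒ : ∀ {x j} → Match x j ≡ false → R i j ≡ eq → x ≢ a (suc (suc i) ∸ j)
    Match-false⇒ {x} {j} ¬match R≡eq x≡a = case trans (sym ¬match) match of λ ()
      where
      match : Match x j ≡ true
      match rewrite R≡eq | x≡a = ==-refl _

    T-cases : ∀ x → (filter (λ j → Match x j Bool.≟ true) (range 2 i) ≡ [] × T i x ≡ (if x == a 1 then suc i else 0))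
                  ⊎ ∃[ t ] ∃[ ts ] filter (λ j → Match x j Bool.≟ true) (range 2 i) ≡ t ∷ ts × T i x ≡ t
    T-cases x with filter (λ j → Match x j Bool.≟ true) (range 2 i) in matches
    ... | []     = inj₁ (refl , refl)
    ... | t ∷ ts = inj₂ (t , ts , refl , refl)

    T≡0⇒unmatched : ∀ {x} → T i x ≡ 0 → ∀ {p} → 1 ≤ p → p ≤ i → R i (suc p) ≡ eq → x ≢ a (suc i ∸ p)
    T≡0⇒unmatched {x} T≡0 {p} 1≤p p≤i R≡eq with T-cases x
    ... | inj₂ (t , ts , matches , T≡t) =
      contradiction (subst (2 ≤_) (trans (sym T≡t) T≡0) (proj₁ (∈-range⁻ 2 i (proj₁ (filter-≡∷⇒ (Match x) {range 2 i} matches))))) λ ()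
    ... | inj₁ (unmatched , T≡) with x == a 1 in x≟a₁ | m≤n⇒m<n∨m≡n p≤i
    ...   | true  | _         = case trans (sym T≡) T≡0 of λ ()
    ...   | false | inj₁ p<i  = Match-false⇒ {j = suc p} (filter-≡[]⇒ (Match x) {range 2 i} unmatched (∈-range⁺ (s≤s 1≤p) p<i)) R≡eq
    ...   | false | inj₂ refl = λ x≡a → ==≡false⇒≢ x≟a₁ (trans x≡a (cong a 1+i∸i≡1))

    -- Tᵢ(x) is the least j ∈ [2, i + 1] with R i j = eq and x = a (i + 2 − j), or 0;
    -- Defs treats j = i + 1, where R i (i + 1) = eq always, by its fallback x == a 1.
    record FirstMatch (x : L) (d : ℕ) : Set where
      field
        d≤i    : d ≤ i
        R≡eq   : R i (suc d) ≡ eq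
        x≡a    : x ≡ a (suc i ∸ d)
        before : ∀ {p} → 1 ≤ p → p < d → R i (suc p) ≡ eq → x ≢ a (suc i ∸ p)

    T≡suc⇒firstMatch : ∀ {x d} → T i x ≡ suc d → FirstMatch x d
    T≡suc⇒firstMatch {x} {d} T≡1+d with T-cases x
    ... | inj₁ (unmatched , T≡) with x == a 1 in x≟a₁
    ...   | false = case trans (sym T≡) T≡1+d of λ ()
    ...   | true with refl ← trans (sym T≡) T≡1+d = record
      { d≤i    = ≤-refl
      ; R≡eq   = R-diag i
      ; x≡a    = trans (==⇒≡ x≟a₁) (cong a (sym 1+i∸i≡1))
      ; before = λ {p} 1≤p p<i → Match-false⇒ {j = suc p} (filter-≡[]⇒ (Match x) {range 2 i} unmatched (∈-range⁺ (s≤s 1≤p) p<i))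
      }
    T≡suc⇒firstMatch {x} {d} T≡1+d | inj₂ (t , ts , matches , T≡t) with refl ← trans (sym T≡t) T≡1+d = record
      { d≤i    = <⇒≤ (proj₂ (∈-range⁻ 2 i (proj₁ (filter-≡∷⇒ (Match x) {range 2 i} matches))))
      ; R≡eq   = isEq⇒≡eq (∧-conicalˡ (isEq (R i (suc d))) (a (suc i ∸ d) == x) match)
      ; x≡a    = sym (==⇒≡ (∧-conicalʳ (isEq (R i (suc d))) (a (suc i ∸ d) == x) match))
      ; before = λ {p} 1≤p p<d → Match-false⇒ {j = suc p} (filter-interval-least (Match x) 2 (suc i ∸ 2) matches (s≤s 1≤p) (s≤s p<d))
      }
      where
      match : Match x (suc d) ≡ true
      match = proj₂ (filter-≡∷⇒ (Match x) {range 2 i} matches)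

    ≤i⇒<∣Y∣ : ∀ x z {p} → p ≤ i → p < length (Y x z)
    ≤i⇒<∣Y∣ x z p≤i = subst (_ <_) (sym (length-Y x z)) (s≤s (≤-trans p≤i (m≤m+n i (length z))))

    Y-exceeds-later : ∀ {x} z {p} → inΣA i x ≡ true → 1 ≤ p → p ≤ i → (R i (suc p) ≡ eq → x ≢ a (suc i ∸ p)) →
                   isGt (merCmp (Y x z ++ w) p) ≡ true
    Y-exceeds-later {x} z {p} σA 1≤p p≤i unmatched = by-cases (R i (suc p)) refl
      where
      by-cases : ∀ r → R i (suc p) ≡ r → isGt (merCmp (Y x z ++ w) p) ≡ true
      by-cases lt R≡lt = contradiction R≡lt (R≢lt p≤i)
      by-cases eq R≡eq = Y-exceeds x z p≤i (inj₂ (R≡eq , ∨-resolveˡ (ΣA-later σA 1≤p p≤i R≡eq) (==-false (unmatched R≡eq))))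
      by-cases gt R≡gt = Y-exceeds x z p≤i (inj₁ R≡gt)

    Y-exceeds-below : ∀ {x} z {e} → inΣA i x ≡ true → e ≤ suc i →
                    (∀ {p} → 1 ≤ p → p < e → R i (suc p) ≡ eq → x ≢ a (suc i ∸ p)) →
                    ∀ p → p < e → isGt (merCmp (Y x z ++ w) p) ≡ true
    Y-exceeds-below {x} z σA e≤1+i unmatched zero    _   = Y-exceeds x z z≤n (inj₂ (R-first i , proj₁ (ΣA-parts σA)))
    Y-exceeds-below {x} z σA e≤1+i unmatched (suc p) p<e =
      Y-exceeds-later z σA (s≤s z≤n) (s≤s⁻¹ (≤-trans p<e e≤1+i)) (unmatched (s≤s z≤n) p<e)

    drop-Y-beyond : ∀ x z → drop (suc i) (Y x z) ≡ z
    drop-Y-beyond x z = begin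
      drop (suc i) (take i w ++ x ∷ z)                                        ≡⟨ drop-++ (suc i) (take i w) (x ∷ z) ⟩
      drop (suc i) (take i w) ++ drop (suc i ∸ length (take i w)) (x ∷ z)     ≡⟨ cong₂ _++_ (drop-all (suc i) (take i w) (≤-trans (≤-reflexive ∣wᵢ∣) (n≤1+n i)))
                                                                                              (cong (λ k → drop (suc i ∸ k) (x ∷ z)) ∣wᵢ∣) ⟩
      drop (suc i ∸ i) (x ∷ z)                                                ≡⟨ cong (λ k → drop k (x ∷ z)) 1+i∸i≡1 ⟩
      z                                                                       ∎
      where open ≡-Reasoning

    drop-Y-within : ∀ x z {d} → d ≤ i → R i (suc d) ≡ eq → x ≡ a (suc i ∸ d) → drop d (Y x z) ≡ take (suc i ∸ d) w ++ z
    drop-Y-within x z {d} d≤i R≡eq x≡a = begin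
      drop d (take i w ++ x ∷ z)                                   ≡⟨ drop-++ d (take i w) (x ∷ z) ⟩
      drop d (take i w) ++ drop (d ∸ length (take i w)) (x ∷ z)    ≡⟨ cong₂ _++_ (R≡eq⇒border (<⇒≤ i<m) d≤i R≡eq) (cong (λ k → drop k (x ∷ z)) d∸∣wᵢ∣≡0) ⟩
      take (i ∸ d) w ++ x ∷ z                                      ≡⟨ cong (λ y → take (i ∸ d) w ++ y ∷ z) (trans x≡a (cong a 1+i∸d≡)) ⟩
      take (i ∸ d) w ++ a (suc (i ∸ d)) ∷ z                        ≡⟨ take-at w (i ∸ d) z (subst (i ∸ d <_) (sym length-w) (≤-<-trans (m∸n≤m i d) i<m)) ⟩
      take (suc (i ∸ d)) w ++ z                                    ≡⟨ cong (λ k → take k w ++ z) 1+i∸d≡ ⟨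
      take (suc i ∸ d) w ++ z                                      ∎
      where
      open ≡-Reasoning
      1+i∸d≡ : suc i ∸ d ≡ suc (i ∸ d)
      1+i∸d≡ = +-∸-assoc 1 d≤i
      d∸∣wᵢ∣≡0 : d ∸ length (take i w) ≡ 0
      d∸∣wᵢ∣≡0 = m≤n⇒m∸n≡0 (subst (d ≤_) (sym ∣wᵢ∣) d≤i)

    Y-antemer-unmatched : ∀ {x} z → inΣA i x ≡ true → T i x ≡ 0 → isAntemer (Y x z) ≡ isAntemer z
    Y-antemer-unmatched {x} z σA T≡0 =
      trans (isAntemer-drop (Y x z) (suc i) (≤i⇒<∣Y∣ x z ≤-refl) (Y-exceeds-below z σA ≤-refl unmatched))
            (cong isAntemer (drop-Y-beyond x z))
      where
      unmatched : ∀ {p} → 1 ≤ p → p < suc i → R i (suc p) ≡ eq → x ≢ a (suc i ∸ p)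
      unmatched 1≤p p<1+i = T≡0⇒unmatched T≡0 1≤p (s≤s⁻¹ p<1+i)

    Y-antemer-matched : ∀ {x d} z → inΣA i x ≡ true → T i x ≡ suc d → isAntemer (Y x z) ≡ isAntemer (take (suc i ∸ d) w ++ z)
    Y-antemer-matched {x} {d} z σA T≡1+d =
      trans (isAntemer-drop (Y x z) d (<⇒≤ (≤i⇒<∣Y∣ x z d≤i)) (Y-exceeds-below z σA (m≤n⇒m≤1+n d≤i) before))
            (cong isAntemer (drop-Y-within x z d≤i R≡eq x≡a))
      where open FirstMatch (T≡suc⇒firstMatch T≡1+d)

    Y-antemer-inadmissible : ∀ {x} z → inΣA i x ≡ false → x ≢ a (suc i) → isAntemer (Y x z) ≡ false
    Y-antemer-inadmissible {x} z ¬σA x≢a with p , p≤i , R≡eq , ¬σ , x≠a ← ΣA-fails ¬σA x≢a =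
      isAntemer-fails (≤i⇒<∣Y∣ x z p≤i) (Y-not-exceeds x z p≤i R≡eq ¬σ (==≡false⇒≢ x≠a))

    ΣA-guard : ∀ {x} z → inΣA i x ≡ true → isAntemer (Y x z) ∧ not (x == a (suc i)) ≡ isAntemer (Y x z)
    ΣA-guard {x} z σA =
      trans (cong (λ t → isAntemer (Y x z) ∧ not t) (==-false (inΣ⇒≢ {suc i} (proj₁ (ΣA-parts σA))))) (∧-identityʳ _)

    reentryTerm : ℕ → L → ℕ
    reentryTerm α x = sum (map (λ i′ → Ai i′ ((α + 1) ∸ T i x)) (range ((i + 2) ∸ T i x) imax))

    letter-contribution : ∀ r x → count (λ z → isAntemer (Y x z) ∧ not (x == a (suc i))) (words r)
                           ≡ (if inΣA i x then (if ⌊ T i x ≟ 0 ⌋ then A r else reentryTerm (suc i + r) x) else 0)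
    letter-contribution r x with inΣA i x in σA
    ... | false = sum-map-zero (cong iverson ∘ vanish) (words r)
      where
      vanish : ∀ z → isAntemer (Y x z) ∧ not (x == a (suc i)) ≡ false
      vanish z with x == a (suc i) in x≟a
      ... | true  = ∧-zeroʳ _
      ... | false = cong (_∧ true) (Y-antemer-inadmissible z σA (==≡false⇒≢ x≟a))
    ... | true with T i x in T≟
    ...   | zero  = trans (count-cong (λ z → trans (ΣA-guard z σA) (Y-antemer-unmatched z σA T≟)) (words r))
                          (sym (length-filter≡count isAntemer (words r)))
    ...   | suc d = begin
      count (λ z → isAntemer (Y x z) ∧ not (x == a (suc i))) (words r)
        ≡⟨ count-cong (λ z → trans (ΣA-guard z σA) (Y-antemer-matched z σA T≟)) (words r) ⟩
      count (λ z → isAntemer (take (suc i ∸ d) w ++ z)) (words r)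
        ≡⟨ count-antemers-with-prefix 1≤m r (≤-trans (m∸n≤m (suc i) d) i<m) ⟩
      sum (map (λ i′ → Ai i′ ((suc i ∸ d) + r)) (range (suc i ∸ d) imax))
        ≡⟨ cong₂ (λ n lo → sum (map (λ i′ → Ai i′ n) (range lo imax))) length≡ start≡ ⟩
      sum (map (λ i′ → Ai i′ ((suc i + r + 1) ∸ suc d)) (range ((i + 2) ∸ suc d) imax)) ∎
      where
      open ≡-Reasoning
      d≤1+i : d ≤ suc i
      d≤1+i = m≤n⇒m≤1+n (FirstMatch.d≤i (T≡suc⇒firstMatch T≟))
      length≡ : (suc i ∸ d) + r ≡ (suc i + r + 1) ∸ suc d
      length≡ = trans (sym (+-∸-comm r d≤1+i)) (cong (_∸ suc d) (+-comm 1 (suc i + r)))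
      start≡ : suc i ∸ d ≡ (i + 2) ∸ suc d
      start≡ = cong (_∸ suc d) (+-comm 2 i)

    lcp-Y≟i : ∀ x z → ⌊ lcp (Y x z) w ≟ i ⌋ ≡ not (x == a (suc i))
    lcp-Y≟i x z rewrite lcp-take-++ i w (x ∷ z) (subst (i ≤_) (sym length-w) (<⇒≤ i<m))
                      | drop-at w i (subst (i <_) (sym length-w) i<m) with x == a (suc i)
    ... | true  = ⌊⌋-false (i + suc _ ≟ i) (m+1+n≢m i)
    ... | false = ⌊⌋-true (i + 0 ≟ i) (+-identityʳ i)

    Ai-recurrence : ∀ r → Ai i (suc i + r) ≡ ΣA0size i * A r + sum (map (reentryTerm (suc i + r)) (ΣAnz i))
    Ai-recurrence r = begin
      Ai i (suc i + r)
        ≡⟨ length-filter≡count q (words (suc i + r)) ⟩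
      count q (words (suc i + r))
        ≡⟨ cong (λ n → count q (words n)) (trans (sym (+-suc i r)) (cong (_+ suc r) (sym ∣wᵢ∣))) ⟩
      count q (words (length (take i w) + suc r))
        ≡⟨ count-words-prefix (take i w) (suc r) q prefix ⟩
      count (q ∘ (take i w ++_)) (words (suc r))
        ≡⟨ count-words-suc (q ∘ (take i w ++_)) r ⟩
      sum (map (λ x → count (λ z → q (Y x z)) (words r)) (allFin _))
        ≡⟨ sum-map-cong (λ x → trans (count-cong (λ z → cong (isAntemer (Y x z) ∧_) (lcp-Y≟i x z)) (words r)) (letter-contribution r x)) (allFin _) ⟩
      sum (map (λ x → if inΣA i x then (if ⌊ T i x ≟ 0 ⌋ then A r else reentryTerm (suc i + r) x) else 0) (allFin _))
        ≡⟨ sum-map-if (inΣA i) (λ x → ⌊ T i x ≟ 0 ⌋) (A r) (reentryTerm (suc i + r)) (allFin _) ⟩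
      count (λ x → inΣA i x ∧ ⌊ T i x ≟ 0 ⌋) (allFin _) * A r + sum (map (reentryTerm (suc i + r)) (ΣAnz i))
        ≡⟨ cong (λ n → n * A r + sum (map (reentryTerm (suc i + r)) (ΣAnz i))) (length-filter≡count (λ x → inΣA i x ∧ ⌊ T i x ≟ 0 ⌋) (allFin _)) ⟨
      ΣA0size i * A r + sum (map (reentryTerm (suc i + r)) (ΣAnz i)) ∎
      where
      open ≡-Reasoning
      q : List L → Bool
      q y = isAntemer y ∧ ⌊ lcp y w ≟ i ⌋
      prefix : ∀ y → q y ≡ true → take (length (take i w)) y ≡ take i w
      prefix y qy = subst (λ n → take n y ≡ take i w) (sym ∣wᵢ∣)
                          (lcp-take i y w (≤-reflexive (sym (⌊⌋≡true⇒ (lcp y w ≟ i) (∧-conicalʳ (isAntemer y) _ qy)))))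

proposition2 : (b : ℕ) (enc : Fin (2 ^ b) ↔ Vec Bool b) (m k : ℕ) → 1 ≤ m → m < k →
    (w γ : Vec (Fin (2 ^ b)) m) → (α i : ℕ) → 1 ≤ α → 0 < i → i < α →
    i < suc (Antemer.imax b enc w γ) →
    let open Antemer b enc w γ in
    Ai i α ≡ ΣA0size i * A (α ∸ suc i)
             + sum (map (λ x → sum (map (λ i′ → Ai i′ ((α + 1) ∸ T i x))
                                        (range ((i + 2) ∸ T i x) imax)))
                        (ΣAnz i))
proposition2 b enc m k 1≤m _ wv γv α i _ _ i<α i<1+imax with r , refl ← m≤n⇒∃[o]m+o≡n i<α =
  trans (Ai-recurrence r) (cong (λ n → ΣA0size i * A n + sum (map (reentryTerm (suc i + r)) (ΣAnz i))) (sym (m+n∸m≡n (suc i) r)))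
  where
  open Antemer b enc wv γv
  open AntemerTheory b enc wv γv
  open Row 1≤m (s≤s⁻¹ i<1+imax)
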